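{- Let $G$ be a finite simple graph, $v\in V(G)$ a simplicial vertex with neighborhood $N(v)$, $k\ge 2$, and $H=G\setminus v$. Then $$\Delta^t_k (G) = \big(\Delta^t_k(H)* v \big) \cup \mathrm{st}_{\Delta^t_{k-1}(H)} N(v).$$
   Context: A vertex $v$ is simplicial if its neighborhood $N(v)$ is a clique. For $j\ge 1$, $\Delta_j^t(G)$ is the simplicial complex on $V(G)$ whose facets are the complements of independent sets of size $j$ (void if there are none). $\Delta*v$ denotes the cone $\{\sigma,\sigma\cup\{v\}:\sigma\in\Delta\}$. For a complex $\Delta$ and a set $\sigma$, the (closed) star is $\mathrm{st}_\Delta\sigma=\{\tau\in\Delta:\sigma\cup\tau\in\Delta\}$. -}

module Defs where

open import Data.Nat using (ℕ)
open import Data.Fin using (Fin)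
open import Data.Fin.Subset using (Subset; _∈_; _⊆_; _∪_; _─_; _-_; ⁅_⁆; ∣_∣; ⊤)
open import Data.Vec using (tabulate)
open import Data.Product using (Σ; _×_; ∃)
open import Data.Sum using (_⊎_)
open import Relation.Nullary using (¬_; Dec; does)
open import Relation.Binary.PropositionalEquality using (_≡_; _≢_)

record Graph (n : ℕ) : Set₁ where
  field
    Adj    : Fin n → Fin n → Set
    adj?   : ∀ x y → Dec (Adj x y)
    sym    : ∀ {x y} → Adj x y → Adj y x
    irrefl : ∀ {x} → ¬ Adj x x
open Graph public

-- A (possibly void) simplicial complex on a subset of Fin n, given by its faces.
Complex : ℕ → Set₁
Complex n = Subset n → Set

N : ∀ {n} → Graph n → Fin n → Subset n
N G v = tabulate (λ x → does (adj? G v x))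

Simplicial : ∀ {n} → Graph n → Fin n → Set
Simplicial G v = ∀ x y → x ∈ N G v → y ∈ N G v → x ≢ y → Adj G x y

Independent : ∀ {n} → Graph n → Subset n → Set
Independent G I = ∀ x y → x ∈ I → y ∈ I → ¬ Adj G x y

-- Δ_j^t of the induced subgraph G[W] (vertex set W ⊆ V(G)):
-- facets are W ∖ I for independent sets I ⊆ W of G[W] with |I| = j;
-- faces are subsets of facets.  Void if no such I exists.
Δt : ∀ {n} → Graph n → Subset n → ℕ → Complex n
Δt G W j σ = Σ (Subset _) λ I →
  (I ⊆ W) × Independent G I × (∣ I ∣ ≡ j) × (σ ⊆ (W ─ I))

Cone : ∀ {n} → Complex n → Fin n → Complex n
Cone Δ v τ = Σ (Subset _) λ σ → Δ σ × ((τ ≡ σ) ⊎ (τ ≡ σ ∪ ⁅ v ⁆))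

Star : ∀ {n} → Complex n → Subset n → Complex n
Star Δ σ τ = Δ τ × Δ (σ ∪ τ)

_∪ᶜ_ : ∀ {n} → Complex n → Complex n → Complex n
(Δ ∪ᶜ Γ) σ = Δ σ ⊎ Γ σ

_≐_ : ∀ {n} → Complex n → Complex n → Set
Δ ≐ Γ = ∀ σ → (Δ σ → Γ σ) × (Γ σ → Δ σ)

{-# OPTIONS --safe #-}
-- Every face σ of Δ_k^t(G) lies in a facet V(G) ∖ I with I independent, |I| = k.
-- If v ∉ I, then I is independent in H and σ - v ⊆ V(H) ∖ I, so σ lies in the
-- cone Δ_k^t(H) * v.  If v ∈ I, then I - v is an independent (k-1)-set of H
-- missing N(v), so N(v) ∪ σ is a face of Δ_{k-1}^t(H), i.e. σ ∈ st N(v).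
-- Conversely a face N(v) ∪ τ ⊆ V(H) ∖ J of Δ_{k-1}^t(H) makes J ∪ {v} an
-- independent k-set of G avoiding τ.
module Submission where

open import Defs hiding (sym)
open import Data.Nat using (ℕ; _≤_; _∸_; suc; s≤s)
open import Data.Nat.Properties using (suc-injective)
open import Data.Fin using (Fin; zero; suc)
open import Data.Fin.Subset
  using (Subset; ⊤; _-_; _∈_; _∉_; _⊆_; _∪_; _─_; ⁅_⁆; ∣_∣; inside; outside)
open import Data.Fin.Subset.Properties
  using (∈⊤; x∈⁅y⁆⇒x≡y; x∉⁅y⁆⇒x≢y; x∈p∪q⁻; x∈p∪q⁺; q⊆p∪q;
         x∈p∧x∉q⇒x∈p─q; x∈p∧x≢y⇒x∈p-y; p─q⊆p; p─⊥≡p; ∪-identityʳ; _∈?_)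
open import Data.Vec using (_∷_; here; there; lookup)
open import Data.Vec.Properties using (lookup∘tabulate; []=⇒lookup; lookup⇒[]=)
open import Data.Bool.Properties using (T-≡)
open import Data.Product using (∃; _×_; _,_)
open import Data.Sum using (_⊎_; inj₁; inj₂; [_,_]′)
open import Function using (_∘_; id; _⇔_; mk⇔)
open import Function.Bundles using (Equivalence)
open import Relation.Nullary using (yes; no; does; isYes; contradiction)
open import Relation.Nullary.Decidable using (dec-true; toWitness; isYes≗does)
open import Relation.Binary.PropositionalEquality
  using (_≡_; _≢_; refl; sym; trans; cong; module ≡-Reasoning)

private
  variable
    n : ℕ

x∈p─q⇒x∉q : ∀ {p q : Subset n} {x} → x ∈ p ─ q → x ∉ q
x∈p─q⇒x∉q {p = inside ∷ p}  {outside ∷ q} here        ()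
x∈p─q⇒x∉q {p = _ ∷ p}       {_ ∷ q}       (there x∈) (there x∈q) = x∈p─q⇒x∉q x∈ x∈q

x∈p-y⇒x≢y : ∀ {p : Subset n} {x y} → x ∈ p - y → x ≢ y
x∈p-y⇒x≢y = x∉⁅y⁆⇒x≢y ∘ x∈p─q⇒x∉q

p⊆q-x⇒x∉p : ∀ {p q : Subset n} {x} → p ⊆ q - x → x ∉ p
p⊆q-x⇒x∉p p⊆q-x x∈p = x∈p-y⇒x≢y (p⊆q-x x∈p) refl

x∉p⇒x∈⊤─p : ∀ {p : Subset n} {x} → x ∉ p → x ∈ ⊤ ─ p
x∉p⇒x∈⊤─p = x∈p∧x∉q⇒x∈p─q ∈⊤

x≢y∧x∉p⇒x∈⊤-y─p : ∀ {p : Subset n} {x y} → x ≢ y → x ∉ p → x ∈ ⊤ - y ─ p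
x≢y∧x∉p⇒x∈⊤-y─p x≢y = x∈p∧x∉q⇒x∈p─q (x∈p∧x≢y⇒x∈p-y ∈⊤ x≢y)

x∉p⇒p-x≡p : ∀ (p : Subset n) x → x ∉ p → p - x ≡ p
x∉p⇒p-x≡p (inside  ∷ p) zero    x∉p = contradiction here x∉p
x∉p⇒p-x≡p (outside ∷ p) zero    _   = cong (outside ∷_) (p─⊥≡p p)
x∉p⇒p-x≡p (s       ∷ p) (suc x) x∉p = cong (s ∷_) (x∉p⇒p-x≡p p x (x∉p ∘ there))

x∈p⇒p-x∪⁅x⁆≡p : ∀ (p : Subset n) x → x ∈ p → (p - x) ∪ ⁅ x ⁆ ≡ p
x∈p⇒p-x∪⁅x⁆≡p (inside  ∷ p) zero    _          = cong (inside ∷_) (trans (∪-identityʳ _) (p─⊥≡p p))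
x∈p⇒p-x∪⁅x⁆≡p (inside  ∷ p) (suc x) (there x∈p) = cong (inside ∷_) (x∈p⇒p-x∪⁅x⁆≡p p x x∈p)
x∈p⇒p-x∪⁅x⁆≡p (outside ∷ p) (suc x) (there x∈p) = cong (outside ∷_) (x∈p⇒p-x∪⁅x⁆≡p p x x∈p)

x∈p⇒∣p∣≡1+∣p-x∣ : ∀ (p : Subset n) x → x ∈ p → ∣ p ∣ ≡ suc ∣ p - x ∣
x∈p⇒∣p∣≡1+∣p-x∣ (inside  ∷ p) zero    _           = cong (suc ∘ ∣_∣) (sym (p─⊥≡p p))
x∈p⇒∣p∣≡1+∣p-x∣ (inside  ∷ p) (suc x) (there x∈p) = cong suc (x∈p⇒∣p∣≡1+∣p-x∣ p x x∈p)
x∈p⇒∣p∣≡1+∣p-x∣ (outside ∷ p) (suc x) (there x∈p) = x∈p⇒∣p∣≡1+∣p-x∣ p x x∈p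

x∉p⇒∣p∪⁅x⁆∣≡1+∣p∣ : ∀ (p : Subset n) x → x ∉ p → ∣ p ∪ ⁅ x ⁆ ∣ ≡ suc ∣ p ∣
x∉p⇒∣p∪⁅x⁆∣≡1+∣p∣ (inside  ∷ p) zero    x∉p = contradiction here x∉p
x∉p⇒∣p∪⁅x⁆∣≡1+∣p∣ (outside ∷ p) zero    _   = cong (suc ∘ ∣_∣) (∪-identityʳ p)
x∉p⇒∣p∪⁅x⁆∣≡1+∣p∣ (inside  ∷ p) (suc x) x∉p = cong suc (x∉p⇒∣p∪⁅x⁆∣≡1+∣p∣ p x (x∉p ∘ there))
x∉p⇒∣p∪⁅x⁆∣≡1+∣p∣ (outside ∷ p) (suc x) x∉p = x∉p⇒∣p∪⁅x⁆∣≡1+∣p∣ p x (x∉p ∘ there)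

DownwardClosed : Complex n → Set
DownwardClosed Δ = ∀ {σ τ} → τ ⊆ σ → Δ σ → Δ τ

Cone-intro : ∀ {Δ : Complex n} {v σ} → Δ (σ - v) → Cone Δ v σ
Cone-intro {v = v} {σ} Δσ-v with v ∈? σ
... | yes v∈σ = σ - v , Δσ-v , inj₂ (sym (x∈p⇒p-x∪⁅x⁆≡p σ v v∈σ))
... | no  v∉σ = σ - v , Δσ-v , inj₁ (sym (x∉p⇒p-x≡p σ v v∉σ))

Cone-elim : ∀ {Δ : Complex n} {v τ} → Cone Δ v τ → ∃ λ σ → Δ σ × τ ⊆ σ ∪ ⁅ v ⁆
Cone-elim (σ , Δσ , inj₁ refl) = σ , Δσ , x∈p∪q⁺ ∘ inj₁
Cone-elim (σ , Δσ , inj₂ refl) = σ , Δσ , id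

Star-intro : ∀ {Δ : Complex n} {σ τ} → DownwardClosed Δ → Δ (σ ∪ τ) → Star Δ σ τ
Star-intro {σ = σ} closed Δσ∪τ = closed (q⊆p∪q σ _) Δσ∪τ , Δσ∪τ

module _ (G : Graph n) where

  Independent-⊆ : ∀ {I J} → J ⊆ I → Independent G I → Independent G J
  Independent-⊆ J⊆I indI x y x∈J y∈J = indI x y (J⊆I x∈J) (J⊆I y∈J)

  ∈N⇔Adj : ∀ {v x} → x ∈ N G v ⇔ Adj G v x
  ∈N⇔Adj {v} {x} = mk⇔ to from
    where
    to : x ∈ N G v → Adj G v x
    to x∈N = toWitness {a? = adj? G v x} (Equivalence.from T-≡ (begin
      isYes (adj? G v x)       ≡⟨ isYes≗does (adj? G v x) ⟩
      does (adj? G v x)        ≡⟨ lookup∘tabulate _ x ⟨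
      lookup (N G v) x         ≡⟨ []=⇒lookup x∈N ⟩
      inside                   ∎))
      where open ≡-Reasoning
    from : Adj G v x → x ∈ N G v
    from adj = lookup⇒[]= x _ (trans (lookup∘tabulate _ x) (dec-true (adj? G v x) adj))

  Δt-downwardClosed : ∀ W j → DownwardClosed (Δt G W j)
  Δt-downwardClosed W j τ⊆σ (I , I⊆W , indI , ∣I∣ , σ⊆) = I , I⊆W , indI , ∣I∣ , σ⊆ ∘ τ⊆σ

  Independent-∪⁅⁆ : ∀ {J v} → Independent G J → (∀ {x} → Adj G v x → x ∉ J) →
                    Independent G (J ∪ ⁅ v ⁆)
  Independent-∪⁅⁆ {J} {v} indJ N∩J≡∅ x y x∈ y∈
    with x∈p∪q⁻ J ⁅ v ⁆ x∈ | x∈p∪q⁻ J ⁅ v ⁆ y∈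
  ... | inj₁ x∈J | inj₁ y∈J = indJ x y x∈J y∈J
  ... | inj₁ x∈J | inj₂ y∈v rewrite x∈⁅y⁆⇒x≡y v y∈v = λ adj → N∩J≡∅ (Graph.sym G adj) x∈J
  ... | inj₂ x∈v | inj₁ y∈J rewrite x∈⁅y⁆⇒x≡y v x∈v = λ adj → N∩J≡∅ adj y∈J
  ... | inj₂ x∈v | inj₂ y∈v rewrite x∈⁅y⁆⇒x≡y v x∈v | x∈⁅y⁆⇒x≡y v y∈v = irrefl G

  Δt-split : ∀ {v j σ} → Δt G ⊤ (suc j) σ →
             Δt G (⊤ - v) (suc j) (σ - v) ⊎ Δt G (⊤ - v) j (N G v ∪ σ)
  Δt-split {v} {j} {σ} (I , _ , indI , ∣I∣ , σ⊆⊤─I) with v ∈? I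
  ... | no v∉I = inj₁ (I , I⊆⊤-v , indI , ∣I∣ , σ-v⊆)
    where
    I⊆⊤-v : I ⊆ ⊤ - v
    I⊆⊤-v x∈I = x∈p∧x≢y⇒x∈p-y ∈⊤ λ { refl → v∉I x∈I }
    σ-v⊆ : σ - v ⊆ ⊤ - v ─ I
    σ-v⊆ x∈σ-v = x≢y∧x∉p⇒x∈⊤-y─p (x∈p-y⇒x≢y x∈σ-v) (x∈p─q⇒x∉q (σ⊆⊤─I (p─q⊆p σ _ x∈σ-v)))
  ... | yes v∈I = inj₂ (I - v , I-v⊆⊤-v , Independent-⊆ (p─q⊆p I _) indI , ∣I-v∣ , N∪σ⊆)
    where
    I-v⊆⊤-v : I - v ⊆ ⊤ - v
    I-v⊆⊤-v = x∈p∧x≢y⇒x∈p-y ∈⊤ ∘ x∈p-y⇒x≢y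
    ∣I-v∣ : ∣ I - v ∣ ≡ j
    ∣I-v∣ = suc-injective (trans (sym (x∈p⇒∣p∣≡1+∣p-x∣ I v v∈I)) ∣I∣)
    outside-I-v : ∀ {x} → x ∉ I → x ∈ ⊤ - v ─ (I - v)
    outside-I-v x∉I = x≢y∧x∉p⇒x∈⊤-y─p (λ { refl → x∉I v∈I }) (x∉I ∘ p─q⊆p I _)
    N∪σ⊆ : N G v ∪ σ ⊆ ⊤ - v ─ (I - v)
    N∪σ⊆ x∈ with x∈p∪q⁻ (N G v) σ x∈
    ... | inj₁ x∈N = outside-I-v λ x∈I → indI v _ v∈I x∈I (Equivalence.to ∈N⇔Adj x∈N)
    ... | inj₂ x∈σ = outside-I-v (x∈p─q⇒x∉q (σ⊆⊤─I x∈σ))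

  Δt-cone : ∀ {v j σ} → Δt G (⊤ - v) j σ → Δt G ⊤ j (σ ∪ ⁅ v ⁆)
  Δt-cone {v} {σ = σ} (I , I⊆⊤-v , indI , ∣I∣ , σ⊆) = I , (λ _ → ∈⊤) , indI , ∣I∣ , σ∪v⊆
    where
    σ∪v⊆ : σ ∪ ⁅ v ⁆ ⊆ ⊤ ─ I
    σ∪v⊆ x∈ with x∈p∪q⁻ σ ⁅ v ⁆ x∈
    ... | inj₁ x∈σ = x∉p⇒x∈⊤─p (x∈p─q⇒x∉q (σ⊆ x∈σ))
    ... | inj₂ x∈v rewrite x∈⁅y⁆⇒x≡y v x∈v = x∉p⇒x∈⊤─p (p⊆q-x⇒x∉p I⊆⊤-v)

  Δt-extend : ∀ {v j τ} → Δt G (⊤ - v) j (N G v ∪ τ) → Δt G ⊤ (suc j) τ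
  Δt-extend {v} {j} {τ} (J , J⊆⊤-v , indJ , ∣J∣ , N∪τ⊆) =
    J ∪ ⁅ v ⁆ , (λ _ → ∈⊤) , Independent-∪⁅⁆ indJ N∩J≡∅ , ∣J∪v∣ , τ⊆
    where
    N∩J≡∅ : ∀ {x} → Adj G v x → x ∉ J
    N∩J≡∅ adj = x∈p─q⇒x∉q (N∪τ⊆ (x∈p∪q⁺ (inj₁ (Equivalence.from ∈N⇔Adj adj))))
    ∣J∪v∣ : ∣ J ∪ ⁅ v ⁆ ∣ ≡ suc j
    ∣J∪v∣ = trans (x∉p⇒∣p∪⁅x⁆∣≡1+∣p∣ J v (p⊆q-x⇒x∉p J⊆⊤-v)) (cong suc ∣J∣)
    τ⊆ : τ ⊆ ⊤ ─ (J ∪ ⁅ v ⁆)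
    τ⊆ x∈τ = x∉p⇒x∈⊤─p ([ x∈p─q⇒x∉q x∈⊤-v─J , x∈p-y⇒x≢y (p─q⊆p _ J x∈⊤-v─J) ∘ x∈⁅y⁆⇒x≡y v ]′
                        ∘ x∈p∪q⁻ J ⁅ v ⁆)
      where x∈⊤-v─J = N∪τ⊆ (q⊆p∪q (N G v) τ x∈τ)

proposition3p9 : ∀ {n} (G : Graph n) (v : Fin n) (k : ℕ) →
    Simplicial G v → 2 ≤ k →
    Δt G ⊤ k ≐ (Cone (Δt G (⊤ - v) k) v ∪ᶜ Star (Δt G (⊤ - v) (k ∸ 1)) (N G v))
proposition3p9 G v (suc k) _ (s≤s _) σ = split , merge
  where
  split : Δt G ⊤ (suc k) σ →
          (Cone (Δt G (⊤ - v) (suc k)) v ∪ᶜ Star (Δt G (⊤ - v) k) (N G v)) σ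
  split face with Δt-split G face
  ... | inj₁ avoiding = inj₁ (Cone-intro avoiding)
  ... | inj₂ linking  = inj₂ (Star-intro (Δt-downwardClosed G (⊤ - v) k) linking)
  merge : (Cone (Δt G (⊤ - v) (suc k)) v ∪ᶜ Star (Δt G (⊤ - v) k) (N G v)) σ →
          Δt G ⊤ (suc k) σ
  merge (inj₁ cone) with Cone-elim cone
  ... | τ , face , σ⊆τ∪v = Δt-downwardClosed G ⊤ (suc k) σ⊆τ∪v (Δt-cone G face)
  merge (inj₂ (_ , linking)) = Δt-extend G linking
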